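{- The family $\mathcal F$ of all finite Hasse forests is a projective Fraïssé family.
   Context: Let $\mathcal L_R=\{R,\le\}$ be a language with two binary relation symbols. A topological $\mathcal L_R$-structure is a zero-dimensional compact metrizable space $A$ together with interpretations $R^A,\le^A$ which are closed subsets of $A^2$ (finite structures carry the discrete topology). An epimorphism $\varphi:A\to B$ between topological $\mathcal L_R$-structures is a continuous surjection such that for each symbol $r\in\mathcal L_R$, $r^B=(\varphi\times\varphi)[r^A]$, i.e. $r^B(b_1,b_2)$ iff there are $a_1,a_2$ with $\varphi(a_i)=b_i$ and $r^A(a_1,a_2)$. A family $\mathcal G$ of topological $\mathcal L_R$-structures is a projective Fraïssé family if (JPP) for all $A,B\in\mathcal G$ there are $C\in\mathcal G$ and epimorphisms $C\to A$, $C\to B$; and (AP) for all $A,B,C\in\mathcal G$ and epimorphisms $\varphi_1:B\to A$, $\varphi_2:C\to A$ there are $D\in\mathcal G$ and epimorphisms $\psi_1:D\to B$, $\psi_2:D\to C$ with $\varphi_1\psi_1=\varphi_2\psi_2$. A Hasse partial order (HPO) is a topological $\mathcal L_R$-structure $P$ in which $\le^P$ is a partial order and $a\,R^P\,b$ holds iff $a=b$ or one of $a,b$ is an immediate $\le^P$-successor of the other (so $R^P$ is the Hasse diagram of $\le^P$, made reflexive). A Hasse forest is an HPO whose Hasse diagram has no cycles. $\mathcal F$ denotes the family of all finite Hasse forests. -}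

module Defs where

open import Data.Nat using (ℕ; suc)
open import Data.Fin using (Fin; zero; suc; inject₁; fromℕ)
open import Data.Product using (Σ; _×_; ∃; ∃-syntax)
open import Data.Sum using (_⊎_)
open import Relation.Nullary using (¬_)
open import Relation.Binary.PropositionalEquality using (_≡_; _≢_)
open import Relation.Binary.Structures using (IsPartialOrder)
open import Function.Definitions using (Injective)

-- A finite L_R-structure (discrete topology), nonempty, with carrier Fin (suc size).
record Str : Set₁ where
  field
    size : ℕ
    R    : Fin (suc size) → Fin (suc size) → Set
    Le   : Fin (suc size) → Fin (suc size) → Set

  Carrier : Set
  Carrier = Fin (suc size)

open Str public

record Epi (A B : Str) : Set where
  field
    fun  : Carrier A → Carrier B
    surj : ∀ b → ∃[ a ] fun a ≡ b
    R-img  : ∀ b₁ b₂ → R B b₁ b₂ → ∃[ a₁ ] ∃[ a₂ ] (fun a₁ ≡ b₁ × fun a₂ ≡ b₂ × R A a₁ a₂)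
    R-pres : ∀ a₁ a₂ → R A a₁ a₂ → R B (fun a₁) (fun a₂)
    Le-img  : ∀ b₁ b₂ → Le B b₁ b₂ → ∃[ a₁ ] ∃[ a₂ ] (fun a₁ ≡ b₁ × fun a₂ ≡ b₂ × Le A a₁ a₂)
    Le-pres : ∀ a₁ a₂ → Le A a₁ a₂ → Le B (fun a₁) (fun a₂)

open Epi public

_<[_]_ : {X : Set} → X → (X → X → Set) → X → Set
a <[ le ] b = le a b × a ≢ b

ImmSucc : {X : Set} → (X → X → Set) → X → X → Set
ImmSucc le a b = a <[ le ] b × (∀ c → ¬ (a <[ le ] c × c <[ le ] b))

record IsHPO (P : Str) : Set where
  field
    isPartialOrder : IsPartialOrder _≡_ (Le P)
    R-hasse : ∀ a b → R P a b → (a ≡ b ⊎ (ImmSucc (Le P) a b ⊎ ImmSucc (Le P) b a))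
    hasse-R : ∀ a b → (a ≡ b ⊎ (ImmSucc (Le P) a b ⊎ ImmSucc (Le P) b a)) → R P a b

Adj : (P : Str) → Carrier P → Carrier P → Set
Adj P a b = R P a b × a ≢ b

record Cycle (P : Str) : Set where
  field
    len : ℕ
    v   : Fin (suc (suc (suc len))) → Carrier P
    inj : Injective _≡_ _≡_ v
    step : ∀ (i : Fin (suc (suc len))) → Adj P (v (inject₁ i)) (v (suc i))
    close : Adj P (v (fromℕ (suc (suc len)))) (v zero)

HasseForest : Str → Set
HasseForest P = IsHPO P × ¬ Cycle P

JPP : (Str → Set) → Set₁
JPP 𝒢 = ∀ A B → 𝒢 A → 𝒢 B → Σ Str λ C → 𝒢 C × Epi C A × Epi C B

AP : (Str → Set) → Set₁
AP 𝒢 = ∀ A B C → 𝒢 A → 𝒢 B → 𝒢 C → (φ₁ : Epi B A) (φ₂ : Epi C A) →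
  Σ Str λ D → 𝒢 D × Σ (Epi D B) λ ψ₁ → Σ (Epi D C) λ ψ₂ →
    ∀ d → fun φ₁ (fun ψ₁ d) ≡ fun φ₂ (fun ψ₂ d)

ProjectiveFraisse : (Str → Set) → Set₁
ProjectiveFraisse 𝒢 = JPP 𝒢 × AP 𝒢

module Submission where

-- Amalgamate φ : B → A and ψ : C → A inside the fibre product {(b , c) | φ b = ψ c}, ordered
-- coordinatewise. For fibre points s ≤ e fix one path from s towards e whose every step moves each
-- coordinate along at most one Hasse edge. Such a step always exists: when both coordinates must move
-- and both images move, they move to covers of one point of A lying below a common point, and in a
-- Hasse forest these coincide. The amalgam is the disjoint union of all these paths; being a union of
-- chains it is a Hasse forest, its covers project to Hasse edges of B and C, and each edge or
-- comparability of B or C is realised on the path between suitable s and e. Joint projection is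
-- amalgamation over the one-point forest.

open import Defs

open import Data.Empty using (⊥; ⊥-elim)
open import Data.Fin as Fin using (Fin; zero; suc; inject₁; fromℕ; _≟_)
open import Data.Fin.Induction using (po-wellFounded; po-noetherian)
import Data.Fin.Properties as Finₚ
open import Data.Fin.Properties using (any?; fromℕ≢inject₁; inject₁-injective)
open import Data.List using (List; []; _∷_; _++_; length; lookup)
open import Data.List.Membership.Propositional.Properties using (∈-lookup)
open import Data.List.Relation.Unary.All as All using (All; []; _∷_)
import Data.List.Relation.Unary.All.Properties as Allₚ
open import Data.List.Relation.Unary.AllPairs as AllPairs using (AllPairs; []; _∷_)
import Data.List.Relation.Unary.AllPairs.Properties as AllPairsₚ
open import Data.Nat using (ℕ; zero; suc; pred; _*_)
open import Data.Product using (_×_; _,_; proj₁; proj₂; ∃; ∃₂; ∃-syntax)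
open import Data.Product.Function.NonDependent.Propositional using (_×-↔_)
open import Data.Product.Properties using (≡-dec)
open import Data.Sum as Sum using (_⊎_; inj₁; inj₂)
open import Function using (_∘_; flip; _↔_; Inverse)
open import Function.Properties.Inverse using (↔-trans)
open import Function.Definitions using (Injective)
open import Induction.WellFounded using (Acc; acc)
open import Relation.Binary.Construct.Closure.ReflexiveTransitive as Star using (Star; ε; _◅_; _◅◅_)
import Relation.Binary.Construct.Flip.EqAndOrd as Flip
open import Relation.Binary.Definitions using (Decidable)
open import Relation.Binary.PropositionalEquality using (_≡_; _≢_; refl; sym; trans; cong; cong₂; subst; subst₂)
open import Relation.Binary.Structures using (IsPartialOrder)
import Relation.Binary.PropositionalEquality as ≡
open import Relation.Nullary using (¬_; Dec; yes; no)

open import Relation.Nullary.Decidable using (_×-dec_; ¬?; map′; decidable-stable; ¬¬-excluded-middle)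

HasseEdge : {X : Set} → (X → X → Set) → X → X → Set
HasseEdge _≤_ x y = ImmSucc _≤_ x y ⊎ ImmSucc _≤_ y x

Comparable : {X : Set} → (X → X → Set) → X → X → Set
Comparable _≤_ x y = x ≤ y ⊎ y ≤ x

LowerCoversComparable : {X : Set} → (X → X → Set) → Set
LowerCoversComparable _≤_ = ∀ {x y w} → ImmSucc _≤_ x w → ImmSucc _≤_ y w → Comparable _≤_ x y

UpperCoversComparable : {X : Set} → (X → X → Set) → Set
UpperCoversComparable _≤_ = ∀ {x y w} → ImmSucc _≤_ w x → ImmSucc _≤_ w y → Comparable _≤_ x y

module _ {X : Set} {_≤_ : X → X → Set} where

  ImmSucc-flip : ∀ {x y} → ImmSucc _≤_ x y → ImmSucc (flip _≤_) y x
  ImmSucc-flip ((x≤y , x≢y) , tight) =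
    (x≤y , x≢y ∘ sym) , λ z ((z≤y , y≢z) , (x≤z , z≢x)) →
      tight z ((x≤z , z≢x ∘ sym) , (z≤y , y≢z ∘ sym))

  HasseEdge-flip : ∀ {x y} → HasseEdge _≤_ x y → HasseEdge (flip _≤_) x y
  HasseEdge-flip = Sum.swap ∘ Sum.map ImmSucc-flip ImmSucc-flip

UpperCoversComparable-flip : ∀ {X : Set} {_≤_ : X → X → Set} →
                             UpperCoversComparable _≤_ → LowerCoversComparable (flip _≤_)
UpperCoversComparable-flip comparable x⋖w y⋖w = Sum.swap (comparable (ImmSucc-flip x⋖w) (ImmSucc-flip y⋖w))

module _ {X : Set} {R : X → X → Set} where

  steps : ∀ {x y} → Star R x y → List X
  steps ε = []
  steps (_◅_ {j = y} _ w) = y ∷ steps w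

  steps-◅◅ : ∀ {x y z} (v : Star R x y) (w : Star R y z) → steps (v ◅◅ w) ≡ steps v ++ steps w
  steps-◅◅ ε w = refl
  steps-◅◅ (r ◅ v) w = cong (_ ∷_) (steps-◅◅ v w)

  Star-lookup : ∀ {x y} (w : Star R x y) (i : Fin (length (steps w))) →
                R (lookup (x ∷ steps w) (inject₁ i)) (lookup (x ∷ steps w) (suc i))
  Star-lookup (r ◅ w) zero = r
  Star-lookup (r ◅ w) (suc i) = Star-lookup w i

  Star-lookup-last : ∀ {x y} (w : Star R x y) → lookup (x ∷ steps w) (fromℕ (length (steps w))) ≡ y
  Star-lookup-last ε = refl
  Star-lookup-last (r ◅ w) = Star-lookup-last w

steps-map : ∀ {X : Set} {R S : X → X → Set} (f : ∀ {x y} → R x y → S x y) {x y} (w : Star R x y) →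
            steps (Star.map f w) ≡ steps w
steps-map f ε = refl
steps-map f (r ◅ w) = cong (_ ∷_) (steps-map f w)

lookup-injective : ∀ {X : Set} {xs : List X} → AllPairs _≢_ xs → Injective _≡_ _≡_ (lookup xs)
lookup-injective (_ ∷ _) {zero} {zero} _ = refl
lookup-injective (x≢ ∷ _) {zero} {suc j} e = ⊥-elim (All.lookup x≢ (∈-lookup j) e)
lookup-injective (x≢ ∷ _) {suc i} {zero} e = ⊥-elim (All.lookup x≢ (∈-lookup i) (sym e))
lookup-injective (_ ∷ distinct) {suc i} {suc j} e = cong suc (lookup-injective distinct e)

module PartialOrderCovers {X : Set} {_≤_ : X → X → Set} (po : IsPartialOrder _≡_ _≤_) where
  open IsPartialOrder po using () renaming (refl to ≤-refl; trans to ≤-trans; antisym to ≤-antisym)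

  _⋖_ : X → X → Set
  _⋖_ = ImmSucc _≤_

  ⋖⇒< : ∀ {x y} → x ⋖ y → x <[ _≤_ ] y
  ⋖⇒< = proj₁

  ⋖⇒≤ : ∀ {x y} → x ⋖ y → x ≤ y
  ⋖⇒≤ = proj₁ ∘ proj₁

  ⋖⇒≢ : ∀ {x y} → x ⋖ y → x ≢ y
  ⋖⇒≢ = proj₂ ∘ proj₁

  ⋖-tight : ∀ {x y z} → x ⋖ z → x <[ _≤_ ] y → y <[ _≤_ ] z → ⊥
  ⋖-tight x⋖z x<y y<z = proj₂ x⋖z _ (x<y , y<z)


  ⋖-≤-≢ : ∀ {x y z} → x ⋖ y → y ≤ z → x ≢ z
  ⋖-≤-≢ x⋖y y≤z refl = ⋖⇒≢ x⋖y (≤-antisym (⋖⇒≤ x⋖y) y≤z)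

  chain-from-start : ∀ {x y} (w : Star _⋖_ x y) → All (x ≤_) (x ∷ steps w)
  chain-from-start ε = ≤-refl ∷ []
  chain-from-start (x⋖z ◅ w) = ≤-refl ∷ All.map (≤-trans (⋖⇒≤ x⋖z)) (chain-from-start w)

  chain-to-end : ∀ {x y} (w : Star _⋖_ x y) → All (_≤ y) (x ∷ steps w)
  chain-to-end ε = ≤-refl ∷ []
  chain-to-end (x⋖z ◅ w) with chain-to-end w
  ... | z≤y ∷ rest = ≤-trans (⋖⇒≤ x⋖z) z≤y ∷ z≤y ∷ rest

  chain-above-start : ∀ {x y} (w : Star _⋖_ x y) → All (λ z → x <[ _≤_ ] z) (steps w)
  chain-above-start ε = []
  chain-above-start (x⋖z ◅ w) =
    All.map (λ z≤v → ≤-trans (⋖⇒≤ x⋖z) z≤v , ⋖-≤-≢ x⋖z z≤v) (chain-from-start w)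

  chain-distinct : ∀ {x y} (w : Star _⋖_ x y) → AllPairs _≢_ (x ∷ steps w)
  chain-distinct ε = [] ∷ []
  chain-distinct (x⋖z ◅ w) = All.map proj₂ (chain-above-start (x⋖z ◅ w)) ∷ chain-distinct w

  -- A walk that starts upwards cannot turn down: at a turn its two neighbours would be distinct,
  -- comparable lower covers of the same point.
  walk-ascends : LowerCoversComparable _≤_ → ∀ n (u : Fin (suc (suc n)) → X) → Injective _≡_ _≡_ u →
                 (∀ i → HasseEdge _≤_ (u (inject₁ i)) (u (suc i))) → u zero ⋖ u (suc zero) →
                 u (inject₁ (fromℕ n)) ⋖ u (fromℕ (suc n)) × u (suc zero) ≤ u (fromℕ (suc n))
  walk-ascends _ zero u _ _ u₀⋖u₁ = u₀⋖u₁ , ≤-refl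
  walk-ascends lower (suc n) u inj edge u₀⋖u₁
    with walk-ascends lower n (u ∘ inject₁) (inject₁-injective ∘ inj) (edge ∘ inject₁) u₀⋖u₁
       | edge (fromℕ (suc n))
  ... | _ , u₁≤w | inj₁ w⋖q = w⋖q , ≤-trans u₁≤w (⋖⇒≤ w⋖q)
  ... | p⋖w , _ | inj₂ q⋖w with lower p⋖w q⋖w
  ...   | inj₁ p≤q = ⊥-elim (⋖-tight p⋖w (p≤q , p≢q) (⋖⇒< q⋖w))
    where p≢q = λ e → fromℕ≢inject₁ (sym (inj e))
  ...   | inj₂ q≤p = ⊥-elim (⋖-tight q⋖w (q≤p , q≢p) (⋖⇒< p⋖w))
    where q≢p = λ e → fromℕ≢inject₁ (inj e)

  no-cycle-starting-upward : LowerCoversComparable _≤_ → ∀ n (v : Fin (suc (suc (suc n))) → X) →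
    Injective _≡_ _≡_ v → (∀ i → HasseEdge _≤_ (v (inject₁ i)) (v (suc i))) →
    HasseEdge _≤_ (v (fromℕ (suc (suc n)))) (v zero) → v zero ⋖ v (suc zero) → ⊥
  no-cycle-starting-upward lower n v inj edge close v₀⋖v₁
    with proj₂ (walk-ascends lower (suc n) v inj edge v₀⋖v₁) | close
  ... | v₁≤vₙ | inj₁ vₙ⋖v₀ with inj (≤-antisym (≤-trans (⋖⇒≤ v₀⋖v₁) v₁≤vₙ) (⋖⇒≤ vₙ⋖v₀))
  ...   | ()
  no-cycle-starting-upward lower n v inj edge close v₀⋖v₁ | v₁≤vₙ | inj₂ v₀⋖vₙ =
    ⋖-tight v₀⋖vₙ (⋖⇒< v₀⋖v₁) (v₁≤vₙ , λ e → index-distinct (inj e))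
    where
    index-distinct : suc zero ≡ fromℕ (suc (suc n)) → ⊥
    index-distinct ()

no-Hasse-cycle : ∀ {X : Set} {_≤_ : X → X → Set} → IsPartialOrder _≡_ _≤_ →
  LowerCoversComparable _≤_ → UpperCoversComparable _≤_ → ∀ n (v : Fin (suc (suc (suc n))) → X) →
  Injective _≡_ _≡_ v → (∀ i → HasseEdge _≤_ (v (inject₁ i)) (v (suc i))) →
  HasseEdge _≤_ (v (fromℕ (suc (suc n)))) (v zero) → ⊥
no-Hasse-cycle {_≤_ = _≤_} po lower upper n v inj edge close with edge zero
... | inj₁ v₀⋖v₁ = PartialOrderCovers.no-cycle-starting-upward po lower n v inj edge close v₀⋖v₁
... | inj₂ v₁⋖v₀ = PartialOrderCovers.no-cycle-starting-upward (Flip.isPartialOrder po)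
      (UpperCoversComparable-flip {_≤_ = _≤_} upper) n v inj (flip-edge ∘ edge) (flip-edge close)
      (ImmSucc-flip {_≤_ = _≤_} v₁⋖v₀)
  where flip-edge = HasseEdge-flip {_≤_ = _≤_}

module _ {P : Str} (hpo : IsHPO P) where
  open IsHPO hpo

  Adj⇒HasseEdge : ∀ {x y} → Adj P x y → HasseEdge (Le P) x y
  Adj⇒HasseEdge {x} {y} (r , x≢y) with R-hasse x y r
  ... | inj₁ x≡y = ⊥-elim (x≢y x≡y)
  ... | inj₂ edge = edge

  HasseEdge⇒Adj : ∀ {x y} → HasseEdge (Le P) x y → Adj P x y
  HasseEdge⇒Adj {x} {y} edge = hasse-R x y (inj₂ edge) , edge-≢ edge
    where
    edge-≢ : HasseEdge (Le P) x y → x ≢ y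
    edge-≢ (inj₁ x⋖y) = proj₂ (proj₁ x⋖y)
    edge-≢ (inj₂ y⋖x) = proj₂ (proj₁ y⋖x) ∘ sym

  HPO-acyclic : LowerCoversComparable (Le P) → UpperCoversComparable (Le P) → ¬ Cycle P
  HPO-acyclic lower upper cycle =
    no-Hasse-cycle isPartialOrder lower upper len v inj (Adj⇒HasseEdge ∘ step) (Adj⇒HasseEdge close)
    where open Cycle cycle

  cycle-from-walk : ∀ {x y₁ y} → HasseEdge (Le P) x y₁ → (w : Star (HasseEdge (Le P)) y₁ y) → y₁ ≢ y →
                    AllPairs _≢_ (x ∷ y₁ ∷ steps w) → HasseEdge (Le P) y x → Cycle P
  cycle-from-walk _ ε y₁≢y _ _ = ⊥-elim (y₁≢y refl)
  cycle-from-walk {x} e (e′ ◅ w) _ distinct closing = record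
    { len = length (steps w)
    ; v = lookup (x ∷ steps walk)
    ; inj = lookup-injective distinct
    ; step = HasseEdge⇒Adj ∘ Star-lookup walk
    ; close = subst (λ z → Adj P z x) (sym (Star-lookup-last walk)) (HasseEdge⇒Adj closing)
    }
    where walk = e ◅ e′ ◅ w

module FinitePoset {n} {_≤_ : Fin n → Fin n → Set} (po : IsPartialOrder _≡_ _≤_) (_≤?_ : Decidable _≤_) where
  open IsPartialOrder po using () renaming (refl to ≤-refl; trans to ≤-trans)
  open PartialOrderCovers po using (_⋖_)

  minimal-below : (Q : Fin n → Set) → (∀ x → Dec (Q x)) → ∀ {t} → Q t →
                  ∃[ m ] (Q m × m ≤ t × ∀ {s} → Q s → s ≤ m → s ≡ m)
  minimal-below Q Q? = go (po-wellFounded po _)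
    where
    go : ∀ {t} → Acc (λ x y → x <[ _≤_ ] y) t → Q t → ∃[ m ] (Q m × m ≤ t × ∀ {s} → Q s → s ≤ m → s ≡ m)
    go {t} (acc below) Qt with any? (λ s → Q? s ×-dec (s ≤? t ×-dec ¬? (s ≟ t)))
    ... | yes (s , Qs , s<t) with go (below s<t) Qs
    ...   | m , Qm , m≤s , minimal = m , Qm , ≤-trans m≤s (proj₁ s<t) , minimal
    go {t} (acc below) Qt | no ∄s =
      t , Qt , ≤-refl , λ {s} Qs s≤t → decidable-stable (s ≟ t) (λ s≢t → ∄s (s , Qs , s≤t , s≢t))

  cover-below : ∀ {x y} → x <[ _≤_ ] y → ∃[ z ] (x ⋖ z × z ≤ y)
  cover-below {x} x<y with minimal-below (x <[ _≤_ ]_) (λ z → x ≤? z ×-dec ¬? (x ≟ z)) x<y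
  ... | z , x<z , z≤y , minimal = z , (x<z , λ c (x<c , c<z) → proj₂ c<z (minimal x<c (proj₁ c<z))) , z≤y

  cover-chain : ∀ {x y} → x ≤ y → Star _⋖_ x y
  cover-chain {y = y} = go (po-noetherian po _)
    where
    go : ∀ {x} → Acc (flip (λ a b → a <[ _≤_ ] b)) x → x ≤ y → Star _⋖_ x y
    go {x} (acc above) x≤y with x ≟ y
    ... | yes refl = ε
    ... | no x≢y with cover-below (x≤y , x≢y)
    ...   | z , x⋖z , z≤y = x⋖z ◅ go (above (proj₁ x⋖z)) z≤y

module HasseForestCovers {P : Str} (forest : HasseForest P) (_≤?_ : Decidable (Le P)) where
  open IsHPO (proj₁ forest)
  private
    _≤_ = Le P
    module Up = PartialOrderCovers isPartialOrder
    module Down = PartialOrderCovers (Flip.isPartialOrder isPartialOrder)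
    module FinUp = FinitePoset isPartialOrder _≤?_
    module FinDown = FinitePoset (Flip.isPartialOrder isPartialOrder) (flip _≤?_)

  -- Cover chains from u and from u′ up to a minimal common upper bound meet only at their top,
  -- so together with a they form a cycle.
  bounded-upper-covers-≡ : ∀ {a u u′ t} → ImmSucc _≤_ a u → ImmSucc _≤_ a u′ → u ≤ t → u′ ≤ t → u ≡ u′
  bounded-upper-covers-≡ {a} {u} {u′} a⋖u a⋖u′ u≤t u′≤t with u ≟ u′
  ... | yes u≡u′ = u≡u′
  ... | no u≢u′ with FinUp.minimal-below (λ s → u ≤ s × u′ ≤ s) (λ s → u ≤? s ×-dec u′ ≤? s) (u≤t , u′≤t)
  ...   | t₀ , (u≤t₀ , u′≤t₀) , _ , minimal =
    ⊥-elim (proj₂ forest (cycle-from-walk (proj₁ forest) (inj₁ a⋖u) walk u≢u′ distinct (inj₂ a⋖u′)))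
    where
    up = FinUp.cover-chain u≤t₀
    down = FinDown.cover-chain u′≤t₀
    walk = Star.map inj₁ up ◅◅ Star.map (inj₂ ∘ ImmSucc-flip {_≤_ = flip _≤_}) down

    walk-steps : steps walk ≡ steps up ++ steps down
    walk-steps = trans (steps-◅◅ (Star.map inj₁ up) _) (cong₂ _++_ (steps-map inj₁ up) (steps-map _ down))

    a-distinct : All (a ≢_) (steps up ++ steps down)
    a-distinct = Allₚ.++⁺ (All.tail (All.map (Up.⋖-≤-≢ a⋖u) (Up.chain-from-start up)))
                          (All.map (Up.⋖-≤-≢ a⋖u′) (All.tail (Down.chain-to-end down)))

    up-down-distinct : All (λ p → All (p ≢_) (steps down)) (u ∷ steps up)
    up-down-distinct = All.map
      (λ u≤p → All.map (λ ((q≤t₀ , t₀≢q) , u′≤q) p≡q →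
                          t₀≢q (sym (minimal (subst (u ≤_) p≡q u≤p , u′≤q) q≤t₀)))
                       (All.zip (Down.chain-above-start down , All.tail (Down.chain-to-end down))))
      (Up.chain-from-start up)

    distinct : AllPairs _≢_ (a ∷ u ∷ steps walk)
    distinct = subst (λ l → AllPairs _≢_ (a ∷ u ∷ l)) (sym walk-steps)
      ((Up.⋖⇒≢ a⋖u ∷ a-distinct) ∷
       AllPairsₚ.++⁺ (Up.chain-distinct up) (AllPairs.tail (Down.chain-distinct down)) up-down-distinct)

UpEdge : (P : Str) → Carrier P → Carrier P → Set
UpEdge P x y = R P x y × Le P x y

module HPO {P : Str} (hpo : IsHPO P) where
  open IsHPO hpo
  open IsPartialOrder isPartialOrder using () renaming (refl to ≤-refl; antisym to ≤-antisym)
  open PartialOrderCovers isPartialOrder public using (_⋖_; ⋖⇒≤; ⋖⇒≢; ⋖-tight)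

  R-refl : ∀ x → R P x x
  R-refl x = hasse-R x x (inj₁ refl)

  R-sym : ∀ {x y} → R P x y → R P y x
  R-sym {x} {y} r with R-hasse x y r
  ... | inj₁ x≡y = hasse-R y x (inj₁ (sym x≡y))
  ... | inj₂ edge = hasse-R y x (inj₂ (Sum.swap edge))

  ⋖⇒UpEdge : ∀ {x y} → x ⋖ y → UpEdge P x y
  ⋖⇒UpEdge {x} {y} x⋖y = hasse-R x y (inj₂ (inj₁ x⋖y)) , ⋖⇒≤ x⋖y

  UpEdge-refl : ∀ {x} → UpEdge P x x
  UpEdge-refl = R-refl _ , ≤-refl

  UpEdge⇒⋖ : ∀ {x y} → UpEdge P x y → x ≢ y → x ⋖ y
  UpEdge⇒⋖ {x} {y} (r , x≤y) x≢y with R-hasse x y r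
  ... | inj₁ x≡y = ⊥-elim (x≢y x≡y)
  ... | inj₂ (inj₁ x⋖y) = x⋖y
  ... | inj₂ (inj₂ y⋖x) = ⊥-elim (x≢y (≤-antisym x≤y (⋖⇒≤ y⋖x)))

  R-stable : ∀ {x y} → Le P x y → ¬ ¬ R P x y → R P x y
  R-stable {x} {y} x≤y ¬¬r with x ≟ y
  ... | yes refl = R-refl x
  ... | no x≢y = hasse-R x y (inj₂ (inj₁ ((x≤y , x≢y) , λ c x<c<y → ¬¬r λ r →
          ⋖-tight (UpEdge⇒⋖ (r , x≤y) x≢y) (proj₁ x<c<y) (proj₂ x<c<y))))

  ⋖-squeeze : ∀ {x y z} → x ≡ y ⊎ x ⋖ y → Le P x z → Le P z y → z ≡ x ⊎ z ≡ y
  ⋖-squeeze (inj₁ refl) x≤z z≤x = inj₁ (≤-antisym z≤x x≤z)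
  ⋖-squeeze {x} {y} {z} (inj₂ x⋖y) x≤z z≤y with z ≟ x | z ≟ y
  ... | yes z≡x | _ = inj₁ z≡x
  ... | no _ | yes z≡y = inj₂ z≡y
  ... | no z≢x | no z≢y = ⊥-elim (⋖-tight x⋖y (x≤z , z≢x ∘ sym) (z≤y , z≢y))

module _ {A B : Str} (hA : IsHPO A) (hB : IsHPO B) (φ : Epi B A) where
  private
    module A = HPO hA
    module B = HPO hB
    f = fun φ
  open IsPartialOrder (IsHPO.isPartialOrder hA) using () renaming (antisym to ≤-antisym)

  Epi-cover-image : ∀ {b b′} → ImmSucc (Le B) b b′ → f b ≢ f b′ → ImmSucc (Le A) (f b) (f b′)
  Epi-cover-image {b} {b′} b⋖b′ fb≢fb′ =
    A.UpEdge⇒⋖ (R-pres φ b b′ (proj₁ (B.⋖⇒UpEdge b⋖b′)) , Le-pres φ b b′ (B.⋖⇒≤ b⋖b′)) fb≢fb′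

  Epi-cover-image-fixed : ∀ {b b′ t} → ImmSucc (Le B) b b′ → Le B b′ t → f t ≡ f b → f b ≡ f b′
  Epi-cover-image-fixed {b} {b′} {t} b⋖b′ b′≤t ft≡fb with f b ≟ f b′
  ... | yes fixed = fixed
  ... | no moved = ⊥-elim (moved (≤-antisym (A.⋖⇒≤ (Epi-cover-image b⋖b′ moved))
                                             (subst (Le A (f b′)) ft≡fb (Le-pres φ b′ t b′≤t))))

  Epi-cover-lift : ∀ {a a′} → ImmSucc (Le A) a a′ →
                   ∃₂ λ b b′ → f b ≡ a × f b′ ≡ a′ × ImmSucc (Le B) b b′
  Epi-cover-lift {a} {a′} a⋖a′ with R-img φ a a′ (proj₁ (A.⋖⇒UpEdge a⋖a′))
  ... | b , b′ , refl , refl , r with IsHPO.R-hasse hB b b′ r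
  ...   | inj₁ refl = ⊥-elim (A.⋖⇒≢ a⋖a′ refl)
  ...   | inj₂ (inj₁ b⋖b′) = b , b′ , refl , refl , b⋖b′
  ...   | inj₂ (inj₂ b′⋖b) = ⊥-elim (A.⋖⇒≢ a⋖a′ (≤-antisym (A.⋖⇒≤ a⋖a′) (Le-pres φ b′ b (B.⋖⇒≤ b′⋖b))))

module HasseStructure {X : Set} {n : ℕ} (enum : Fin (suc n) ↔ X) (_⊑_ : X → X → Set) where
  open Inverse enum using (to; from; strictlyInverseˡ; strictlyInverseʳ)

  _⊑ᶠ_ : Fin (suc n) → Fin (suc n) → Set
  i ⊑ᶠ j = to i ⊑ to j

  Hasse : Str
  Hasse = record { size = n ; R = λ i j → i ≡ j ⊎ HasseEdge _⊑ᶠ_ i j ; Le = _⊑ᶠ_ }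

  to-injective : ∀ {i j} → to i ≡ to j → i ≡ j
  to-injective {i} {j} e = trans (sym (strictlyInverseʳ i)) (trans (cong from e) (strictlyInverseʳ j))

  ⋖-to : ∀ {i j} → ImmSucc _⊑ᶠ_ i j → ImmSucc _⊑_ (to i) (to j)
  ⋖-to {i} {j} ((i⊑j , i≢j) , tight) = (i⊑j , i≢j ∘ to-injective) , λ x between →
    tight (from x) (lower (subst Between (sym (strictlyInverseˡ x)) between))
    where
    Between : X → Set
    Between x = to i <[ _⊑_ ] x × x <[ _⊑_ ] to j
    lower : ∀ {c} → Between (to c) → i <[ _⊑ᶠ_ ] c × c <[ _⊑ᶠ_ ] j
    lower ((i⊑c , i≢c) , (c⊑j , c≢j)) = (i⊑c , i≢c ∘ cong to) , (c⊑j , c≢j ∘ cong to)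

  ⋖-from : ∀ {x y} → ImmSucc _⊑_ x y → ImmSucc _⊑ᶠ_ (from x) (from y)
  ⋖-from {x} {y} x⋖y with subst₂ (ImmSucc _⊑_) (sym (strictlyInverseˡ x)) (sym (strictlyInverseˡ y)) x⋖y
  ... | (x⊑y , x≢y) , tight = (x⊑y , x≢y ∘ cong to) , λ c ((x⊑c , x≢c) , (c⊑y , c≢y)) →
    tight (to c) ((x⊑c , x≢c ∘ to-injective) , (c⊑y , c≢y ∘ to-injective))

  Hasse-HasseForest : IsPartialOrder _≡_ _⊑_ → LowerCoversComparable _⊑_ → UpperCoversComparable _⊑_ →
                      HasseForest Hasse
  Hasse-HasseForest po lower upper = hpo , HPO-acyclic hpo
    (λ i⋖k j⋖k → lower (⋖-to i⋖k) (⋖-to j⋖k)) (λ k⋖i k⋖j → upper (⋖-to k⋖i) (⋖-to k⋖j))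
    where
    open IsPartialOrder po using (reflexive; antisym) renaming (trans to ⊑-trans)
    hpo : IsHPO Hasse
    hpo = record
      { isPartialOrder = record
        { isPreorder = record
          { isEquivalence = ≡.isEquivalence
          ; reflexive = λ { refl → reflexive refl }
          ; trans = ⊑-trans }
        ; antisym = λ i⊑j j⊑i → to-injective (antisym i⊑j j⊑i) }
      ; R-hasse = λ _ _ r → r
      ; hasse-R = λ _ _ r → r }

  module _ {B : Str} (hB : IsHPO B) (p : X → Carrier B) where
    private module B = HPO hB

    Hasse-epi : (∀ b → ∃[ x ] p x ≡ b) →
                (∀ {x y} → x ⊑ y → Le B (p x) (p y)) →
                (∀ {b b′} → Le B b b′ → ∃₂ λ x y → p x ≡ b × p y ≡ b′ × x ⊑ y) →
                (∀ {x y} → ImmSucc _⊑_ x y → R B (p x) (p y)) →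
                (∀ {b b′} → ImmSucc (Le B) b b′ → ∃₂ λ x y → p x ≡ b × p y ≡ b′ × ImmSucc _⊑_ x y) →
                Epi Hasse B
    Hasse-epi p-surj p-mono p-Le-img p-cover p-cover-lift = record
      { fun = p ∘ to
      ; surj = λ b → from (proj₁ (p-surj b)) , p-from (proj₂ (p-surj b))
      ; R-img = R-img′
      ; R-pres = R-pres′
      ; Le-img = λ b b′ b≤b′ → let x , y , px , py , x⊑y = p-Le-img b≤b′ in
          from x , from y , p-from px , p-from py ,
          subst₂ _⊑_ (sym (strictlyInverseˡ x)) (sym (strictlyInverseˡ y)) x⊑y
      ; Le-pres = λ _ _ → p-mono
      }
      where
      p-from : ∀ {x b} → p x ≡ b → p (to (from x)) ≡ b
      p-from {x} px = trans (cong p (strictlyInverseˡ x)) px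

      lift : ∀ {b b′} → ImmSucc (Le B) b b′ → ∃₂ λ i j → p (to i) ≡ b × p (to j) ≡ b′ × ImmSucc _⊑ᶠ_ i j
      lift b⋖b′ = let x , y , px , py , x⋖y = p-cover-lift b⋖b′ in
                  from x , from y , p-from px , p-from py , ⋖-from x⋖y

      R-img′ : ∀ b b′ → R B b b′ → ∃₂ λ i j → p (to i) ≡ b × p (to j) ≡ b′ × R Hasse i j
      R-img′ b b′ r with IsHPO.R-hasse hB b b′ r
      ... | inj₁ refl = let x , px = p-surj b in from x , from x , p-from px , p-from px , inj₁ refl
      ... | inj₂ (inj₁ b⋖b′) = let i , j , pi , pj , i⋖j = lift b⋖b′ in i , j , pi , pj , inj₂ (inj₁ i⋖j)
      ... | inj₂ (inj₂ b′⋖b) = let i , j , pi , pj , i⋖j = lift b′⋖b in j , i , pj , pi , inj₂ (inj₂ i⋖j)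

      R-pres′ : ∀ i j → R Hasse i j → R B (p (to i)) (p (to j))
      R-pres′ i .i (inj₁ refl) = B.R-refl _
      R-pres′ i j (inj₂ (inj₁ i⋖j)) = p-cover (⋖-to i⋖j)
      R-pres′ i j (inj₂ (inj₂ j⋖i)) = B.R-sym (p-cover (⋖-to j⋖i))

¬¬-∀-Fin : ∀ n {Q : Fin n → Set} → (∀ i → ¬ ¬ Q i) → ¬ ¬ (∀ i → Q i)
¬¬-∀-Fin zero _ ¬all = ¬all λ ()
¬¬-∀-Fin (suc n) ¬¬Q ¬all = ¬¬Q zero λ Q₀ → ¬¬-∀-Fin n (¬¬Q ∘ suc) λ Qₛ →
  ¬all λ { zero → Q₀ ; (suc i) → Qₛ i }

¬¬-Decidable : ∀ {m n} (Q : Fin m → Fin n → Set) → ¬ ¬ Decidable Q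
¬¬-Decidable {m} {n} Q = ¬¬-∀-Fin m λ x → ¬¬-∀-Fin n λ y → ¬¬-excluded-middle

Star-target : ∀ {X : Set} {R : X → X → Set} (Q : X → Set) → (∀ {x y} → R x y → Q y) →
              ∀ {x y} → Q x → Star R x y → Q y
Star-target Q R⇒Q Qx ε = Qx
Star-target Q R⇒Q Qx (r ◅ w) = Star-target Q R⇒Q (R⇒Q r) w

Star-deterministic-comparable : ∀ {X : Set} {R : X → X → Set} → (∀ {x y y′} → R x y → R x y′ → y ≡ y′) →
                                ∀ {s y y′} → Star R s y → Star R s y′ → Star R y y′ ⊎ Star R y′ y
Star-deterministic-comparable det ε w′ = inj₁ w′
Star-deterministic-comparable det (r ◅ w) ε = inj₂ (r ◅ w)
Star-deterministic-comparable det (r ◅ w) (r′ ◅ w′) with det r r′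
... | refl = Star-deterministic-comparable det w w′

module _ {X : Set} {m : ℕ} (enum : Fin m ↔ X) (S : X → X → Set) where
  open Inverse enum using (to; from; strictlyInverseˡ; strictlyInverseʳ)

  LeastSucc : X → X → Set
  LeastSucc x y = S x y × ∀ {y′} → S x y′ → from y Fin.≤ from y′

  LeastSucc-deterministic : ∀ {x y y′} → LeastSucc x y → LeastSucc x y′ → y ≡ y′
  LeastSucc-deterministic {y = y} {y′} (Sxy , least) (Sxy′ , least′) = begin
    y             ≡⟨ strictlyInverseˡ y ⟨
    to (from y)   ≡⟨ cong to (Finₚ.≤-antisym (least Sxy′) (least′ Sxy)) ⟩
    to (from y′)  ≡⟨ strictlyInverseˡ y′ ⟩
    y′            ∎
    where open ≡.≡-Reasoning

  LeastSucc-exists : (∀ x y → Dec (S x y)) → ∀ {x y} → S x y → ∃ (LeastSucc x)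
  LeastSucc-exists S? {x} {y} Sxy
    with FinitePoset.minimal-below Finₚ.≤-isPartialOrder Finₚ._≤?_ (S x ∘ to) (S? x ∘ to)
                                   (subst (S x) (sym (strictlyInverseˡ y)) Sxy)
  ... | i , Sxi , _ , minimal = to i , Sxi , λ {y′} Sxy′ →
    subst (Fin._≤ from y′) (sym (strictlyInverseʳ i)) (least (subst (S x) (sym (strictlyInverseˡ y′)) Sxy′))
    where
    least : ∀ {j} → S x (to j) → i Fin.≤ j
    least {j} Sxj with Finₚ.≤-total i j
    ... | inj₁ i≤j = i≤j
    ... | inj₂ j≤i = Finₚ.≤-reflexive (sym (minimal Sxj j≤i))

module ChainSum {I Y : Set} {_≤_ : Y → Y → Set} (po : IsPartialOrder _≡_ _≤_) (K : I → Y → Set)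
                (K-chain : ∀ {k x y} → K k x → K k y → Comparable _≤_ x y) where
  open IsPartialOrder po using () renaming (trans to ≤-trans; antisym to ≤-antisym)

  _≤[_]_ : Y → I → Y → Set
  x ≤[ k ] y = K k x × K k y × x ≤ y

  data _⊑_ : I × Y → I × Y → Set where
    ⊑-refl : ∀ {p} → p ⊑ p
    ⊑-chain : ∀ {k x y} → x ≤[ k ] y → (k , x) ⊑ (k , y)

  ⊑-isPartialOrder : IsPartialOrder _≡_ _⊑_
  ⊑-isPartialOrder = record
    { isPreorder = record
      { isEquivalence = ≡.isEquivalence
      ; reflexive = λ { refl → ⊑-refl }
      ; trans = ⊑-trans }
    ; antisym = ⊑-antisym }
    where
    ⊑-trans : ∀ {p q r} → p ⊑ q → q ⊑ r → p ⊑ r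
    ⊑-trans ⊑-refl q⊑r = q⊑r
    ⊑-trans p⊑q ⊑-refl = p⊑q
    ⊑-trans (⊑-chain (Kx , _ , x≤y)) (⊑-chain (_ , Kz , y≤z)) = ⊑-chain (Kx , Kz , ≤-trans x≤y y≤z)
    ⊑-antisym : ∀ {p q} → p ⊑ q → q ⊑ p → p ≡ q
    ⊑-antisym ⊑-refl _ = refl
    ⊑-antisym (⊑-chain _) ⊑-refl = refl
    ⊑-antisym (⊑-chain (_ , _ , x≤y)) (⊑-chain (_ , _ , y≤x)) = cong (_ ,_) (≤-antisym x≤y y≤x)

  private
    comparable-within : ∀ {k x y} → K k x → K k y → Comparable _⊑_ (k , x) (k , y)
    comparable-within Kx Ky =
      Sum.map (λ x≤y → ⊑-chain (Kx , Ky , x≤y)) (λ y≤x → ⊑-chain (Ky , Kx , y≤x)) (K-chain Kx Ky)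

  lower-covers-comparable : LowerCoversComparable _⊑_
  lower-covers-comparable ((⊑-refl , p≢r) , _) _ = ⊥-elim (p≢r refl)
  lower-covers-comparable ((⊑-chain _ , _) , _) ((⊑-refl , q≢r) , _) = ⊥-elim (q≢r refl)
  lower-covers-comparable ((⊑-chain (Kx , _) , _) , _) ((⊑-chain (Ky , _) , _) , _) = comparable-within Kx Ky

  upper-covers-comparable : UpperCoversComparable _⊑_
  upper-covers-comparable ((⊑-refl , r≢p) , _) _ = ⊥-elim (r≢p refl)
  upper-covers-comparable ((⊑-chain _ , _) , _) ((⊑-refl , r≢q) , _) = ⊥-elim (r≢q refl)
  upper-covers-comparable ((⊑-chain (_ , Kx , _) , _) , _) ((⊑-chain (_ , Ky , _) , _) , _) = comparable-within Kx Ky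

  data ChainCover : I × Y → I × Y → Set where
    chain-cover : ∀ {k x y} → ImmSucc _≤[ k ]_ x y → ChainCover (k , x) (k , y)

  ⋖-chain⁻ : ∀ {p q} → ImmSucc _⊑_ p q → ChainCover p q
  ⋖-chain⁻ ((⊑-refl , p≢q) , _) = ⊥-elim (p≢q refl)
  ⋖-chain⁻ {k , x} {.k , y} ((⊑-chain x≤y , p≢q) , tight) =
    chain-cover ((x≤y , p≢q ∘ cong (k ,_)) , λ z ((x≤z , x≢z) , (z≤y , z≢y)) →
      tight (k , z) ((⊑-chain x≤z , x≢z ∘ cong proj₂) , (⊑-chain z≤y , z≢y ∘ cong proj₂)))

  ⋖-chain⁺ : ∀ {k x y} → ImmSucc _≤[ k ]_ x y → ImmSucc _⊑_ (k , x) (k , y)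
  ⋖-chain⁺ {k} ((x≤y , x≢y) , tight) = (⊑-chain x≤y , x≢y ∘ cong proj₂) , middle
    where
    middle : ∀ r → ¬ ((k , _) <[ _⊑_ ] r × r <[ _⊑_ ] (k , _))
    middle _ ((⊑-refl , x≢r) , _) = x≢r refl
    middle _ ((⊑-chain _ , _) , (⊑-refl , r≢y)) = r≢y refl
    middle _ ((⊑-chain x≤z , x≢z) , (⊑-chain z≤y , z≢y)) =
      tight _ ((x≤z , x≢z ∘ cong (k ,_)) , (z≤y , z≢y ∘ cong (k ,_)))

module Amalgam {A B C : Str} (forestA : HasseForest A) (hB : IsHPO B) (hC : IsHPO C) (φ : Epi B A) (ψ : Epi C A) where
  private
    hA = proj₁ forestA
    module A = HPO hA
    module B = HPO hB
    module C = HPO hC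
    module ≤B = IsPartialOrder (IsHPO.isPartialOrder hB)
    module ≤C = IsPartialOrder (IsHPO.isPartialOrder hC)
    f = fun φ
    g = fun ψ

  Pt : Set
  Pt = Carrier B × Carrier C

  _≤ₚ_ : Pt → Pt → Set
  (b , c) ≤ₚ (b′ , c′) = Le B b b′ × Le C c c′

  ≤ₚ-isPartialOrder : IsPartialOrder _≡_ _≤ₚ_
  ≤ₚ-isPartialOrder = record
    { isPreorder = record
      { isEquivalence = ≡.isEquivalence
      ; reflexive = λ { refl → ≤B.refl , ≤C.refl }
      ; trans = λ (b≤ , c≤) (b≤′ , c≤′) → ≤B.trans b≤ b≤′ , ≤C.trans c≤ c≤′ }
    ; antisym = λ (b≤ , c≤) (b≥ , c≥) → cong₂ _,_ (≤B.antisym b≤ b≥) (≤C.antisym c≤ c≥) }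

  open IsPartialOrder ≤ₚ-isPartialOrder using ()
    renaming (refl to ≤ₚ-refl; trans to ≤ₚ-trans; antisym to ≤ₚ-antisym)

  InFibre : Pt → Set
  InFibre (b , c) = f b ≡ g c

  record Step (e x y : Pt) : Set where
    field
      distinct : x ≢ y
      fibre    : InFibre y
      bounded  : y ≤ₚ e
      rise₁    : UpEdge B (proj₁ x) (proj₁ y)
      rise₂    : UpEdge C (proj₂ x) (proj₂ y)

  Step-≤ : ∀ {e x y} → Step e x y → x ≤ₚ y
  Step-≤ step = proj₂ (Step.rise₁ step) , proj₂ (Step.rise₂ step)

  step-in-B : ∀ {e b b′ c} → ImmSucc (Le B) b b′ → InFibre (b′ , c) → (b′ , c) ≤ₚ e → Step e (b , c) (b′ , c)
  step-in-B b⋖b′ fibre bounded = record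
    { distinct = B.⋖⇒≢ b⋖b′ ∘ cong proj₁ ; fibre = fibre ; bounded = bounded
    ; rise₁ = B.⋖⇒UpEdge b⋖b′ ; rise₂ = C.UpEdge-refl }

  step-in-C : ∀ {e b c c′} → ImmSucc (Le C) c c′ → InFibre (b , c′) → (b , c′) ≤ₚ e → Step e (b , c) (b , c′)
  step-in-C c⋖c′ fibre bounded = record
    { distinct = C.⋖⇒≢ c⋖c′ ∘ cong proj₂ ; fibre = fibre ; bounded = bounded
    ; rise₁ = B.UpEdge-refl ; rise₂ = C.⋖⇒UpEdge c⋖c′ }

  step-in-both : ∀ {e b b′ c c′} → ImmSucc (Le B) b b′ → ImmSucc (Le C) c c′ →
                 InFibre (b′ , c′) → (b′ , c′) ≤ₚ e → Step e (b , c) (b′ , c′)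
  step-in-both b⋖b′ c⋖c′ fibre bounded = record
    { distinct = B.⋖⇒≢ b⋖b′ ∘ cong proj₁ ; fibre = fibre ; bounded = bounded
    ; rise₁ = B.⋖⇒UpEdge b⋖b′ ; rise₂ = C.⋖⇒UpEdge c⋖c′ }

  enumPt : Fin (suc (size B) * suc (size C)) ↔ Pt
  enumPt = Finₚ.*↔×

  -- Choosing the Step of least index makes the path from a start point deterministic, hence a chain.
  Next : Pt → Pt → Pt → Set
  Next e = LeastSucc enumPt (Step e)

  Next-deterministic : ∀ {e x y y′} → Next e x y → Next e x y′ → y ≡ y′
  Next-deterministic {e} = LeastSucc-deterministic enumPt (Step e)

  Path-≤ : ∀ {e x y} → Star (Next e) x y → x ≤ₚ y
  Path-≤ = Star.fold _≤ₚ_ (λ n y≤z → ≤ₚ-trans (Step-≤ (proj₁ n)) y≤z) ≤ₚ-refl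

  record Valid (s e : Pt) : Set where
    constructor valid
    field
      start-fibre : InFibre s
      start≤end   : s ≤ₚ e
      end-fibre   : InFibre e

  -- The end e is added explicitly: the path does reach it, but this can only be shown assuming
  -- decidable relations.
  Kept : Pt × Pt → Pt → Set
  Kept (s , e) y = Valid s e × (Star (Next e) s y ⊎ y ≡ e)

  Kept-fibre : ∀ {s e y} → Kept (s , e) y → InFibre y
  Kept-fibre (v , inj₁ path) = Star-target InFibre (Step.fibre ∘ proj₁) (Valid.start-fibre v) path
  Kept-fibre (v , inj₂ refl) = Valid.end-fibre v

  Kept-≤-end : ∀ {s e y} → Kept (s , e) y → y ≤ₚ e
  Kept-≤-end (v , inj₁ path) = Star-target (_≤ₚ _) (Step.bounded ∘ proj₁) (Valid.start≤end v) path
  Kept-≤-end (v , inj₂ refl) = ≤ₚ-refl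

  Kept-comparable : ∀ {k x y} → Kept k x → Kept k y → Comparable _≤ₚ_ x y
  Kept-comparable (_ , inj₁ path) (_ , inj₁ path′) =
    Sum.map Path-≤ Path-≤ (Star-deterministic-comparable Next-deterministic path path′)
  Kept-comparable Kx@(_ , inj₁ _) (_ , inj₂ refl) = inj₁ (Kept-≤-end Kx)
  Kept-comparable (_ , inj₂ refl) Ky@(_ , inj₁ _) = inj₂ (Kept-≤-end Ky)
  Kept-comparable (_ , inj₂ refl) (_ , inj₂ refl) = inj₁ ≤ₚ-refl

  below-Kept-≢-end : ∀ {s e x y} → Kept (s , e) y → x ≤ₚ y → x ≢ y → x ≢ e
  below-Kept-≢-end Ky x≤y x≢y refl = x≢y (≤ₚ-antisym x≤y (Kept-≤-end Ky))

  Next-below-Kept : ∀ {s e x y z} → Star (Next e) s x → Next e x z → Kept (s , e) y → x ≤ₚ y → x ≢ y → z ≤ₚ y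
  Next-below-Kept _ next (_ , inj₂ refl) _ _ = Step.bounded (proj₁ next)
  Next-below-Kept path next (_ , inj₁ path′) x≤y x≢y with Star-deterministic-comparable Next-deterministic path path′
  ... | inj₁ ε = ⊥-elim (x≢y refl)
  ... | inj₁ (next′ ◅ rest) rewrite Next-deterministic next next′ = Path-≤ rest
  ... | inj₂ y→x = ⊥-elim (x≢y (≤ₚ-antisym x≤y (Path-≤ y→x)))

  open ChainSum ≤ₚ-isPartialOrder Kept Kept-comparable public

  private
    M = suc (size B) * suc (size C)

  -- suc (pred ((M * M) * M)) reduces to (M * M) * M because M is a product of successors.
  enum : Fin (suc (pred ((M * M) * M))) ↔ ((Pt × Pt) × Pt)
  enum = ↔-trans Finₚ.*↔× (↔-trans Finₚ.*↔× (enumPt ×-↔ enumPt) ×-↔ enumPt)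

  open HasseStructure enum _⊑_ using (Hasse-HasseForest; Hasse-epi)

  D : Str
  D = HasseStructure.Hasse enum _⊑_

  module Decided (_≤A?_ : Decidable (Le A)) (_≤B?_ : Decidable (Le B)) (_≤C?_ : Decidable (Le C))
                 (R-B? : Decidable (R B)) (R-C? : Decidable (R C)) where
    private
      module FB = FinitePoset (IsHPO.isPartialOrder hB) _≤B?_
      module FC = FinitePoset (IsHPO.isPartialOrder hC) _≤C?_
    open HasseForestCovers forestA _≤A?_ using (bounded-upper-covers-≡)

    Step? : ∀ e x y → Dec (Step e x y)
    Step? (b₂ , c₂) x (b′ , c′) =
      map′ (λ (x≢y , fy , (b≤ , c≤) , r₁ , r₂) → record
              { distinct = x≢y ; fibre = fy ; bounded = b≤ , c≤ ; rise₁ = r₁ ; rise₂ = r₂ })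
           (λ step → Step.distinct step , Step.fibre step , Step.bounded step , Step.rise₁ step , Step.rise₂ step)
           (¬? (≡-dec _≟_ _≟_ x (b′ , c′)) ×-dec f b′ ≟ g c′ ×-dec (b′ ≤B? b₂ ×-dec c′ ≤C? c₂) ×-dec
            (R-B? (proj₁ x) b′ ×-dec proj₁ x ≤B? b′) ×-dec (R-C? (proj₂ x) c′ ×-dec proj₂ x ≤C? c′))

    step-exists : ∀ {e x} → InFibre x → x ≤ₚ e → InFibre e → x ≢ e → ∃ (Step e x)
    step-exists {b₂ , c₂} {b , c} fx (b≤b₂ , c≤c₂) fe x≢e with b ≟ b₂ | c ≟ c₂
    ... | yes refl | yes refl = ⊥-elim (x≢e refl)
    ... | yes refl | no c≢c₂ with FC.cover-below (c≤c₂ , c≢c₂)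
    ...   | c′ , c⋖c′ , c′≤c₂ = (b , c′) ,
      step-in-C c⋖c′ (trans fx (Epi-cover-image-fixed hA hC ψ c⋖c′ c′≤c₂ (trans (sym fe) fx))) (b≤b₂ , c′≤c₂)
    step-exists {b₂ , c₂} {b , c} fx (b≤b₂ , c≤c₂) fe x≢e | no b≢b₂ | c≟c₂ with FB.cover-below (b≤b₂ , b≢b₂)
    ... | b′ , b⋖b′ , b′≤b₂ with f b ≟ f b′ | c≟c₂
    ...   | yes fixed | _ = (b′ , c) , step-in-B b⋖b′ (trans (sym fixed) fx) (b′≤b₂ , c≤c₂)
    ...   | no moved | yes refl = ⊥-elim (moved (Epi-cover-image-fixed hA hB φ b⋖b′ b′≤b₂ (trans fe (sym fx))))
    ...   | no moved | no c≢c₂ with FC.cover-below (c≤c₂ , c≢c₂)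
    ...     | c′ , c⋖c′ , c′≤c₂ with g c ≟ g c′
    ...       | yes fixed = (b , c′) , step-in-C c⋖c′ (trans fx fixed) (b≤b₂ , c′≤c₂)
    ...       | no moved′ = (b′ , c′) , step-in-both b⋖b′ c⋖c′ images-agree (b′≤b₂ , c′≤c₂)
      where
      images-agree : f b′ ≡ g c′
      images-agree = bounded-upper-covers-≡
        (Epi-cover-image hA hB φ b⋖b′ moved)
        (subst (λ a → ImmSucc (Le A) a (g c′)) (sym fx) (Epi-cover-image hA hC ψ c⋖c′ moved′))
        (Le-pres φ b′ b₂ b′≤b₂) (subst (Le A (g c′)) (sym fe) (Le-pres ψ c′ c₂ c′≤c₂))

    -- The successor z of x on the path is kept and lies between x and y, so it is y.
    cover⇒Step : ∀ {s e x y} → ImmSucc _≤[ s , e ]_ x y → Step e x y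
    cover⇒Step {s} {e} {x} {y} (((Kx@(v , on-path) , Ky , x≤y) , x≢y) , tight)
      with on-path | LeastSucc-exists enumPt (Step e) (Step? e) (proj₂ (step-exists
                       (Kept-fibre Kx) (Kept-≤-end Kx) (Valid.end-fibre v) (below-Kept-≢-end Ky x≤y x≢y)))
    ... | inj₂ refl | _ = ⊥-elim (below-Kept-≢-end Ky x≤y x≢y refl)
    ... | inj₁ path | z , next with ≡-dec _≟_ _≟_ z y
    ...   | yes refl = proj₁ next
    ...   | no z≢y = ⊥-elim (tight z (((Kx , Kz , Step-≤ (proj₁ next)) , Step.distinct (proj₁ next)) ,
                                       ((Kz , Ky , Next-below-Kept path next Ky x≤y x≢y) , z≢y)))
      where
      Kz : Kept (s , e) z
      Kz = v , inj₁ (path ◅◅ (next ◅ ε))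

  -- The relations of a finite structure need not be decidable, but for a negative goal we may assume they are.
  cover⇒¬¬Step : ∀ {s e x y} → ImmSucc _≤[ s , e ]_ x y → ¬ ¬ Step e x y
  cover⇒¬¬Step x⋖y ¬step =
    ¬¬-Decidable (Le A) λ _≤A?_ → ¬¬-Decidable (Le B) λ _≤B?_ → ¬¬-Decidable (Le C) λ _≤C?_ →
    ¬¬-Decidable (R B) λ R-B? → ¬¬-Decidable (R C) λ R-C? →
    ¬step (Decided.cover⇒Step _≤A?_ _≤B?_ _≤C?_ R-B? R-C? x⋖y)

  -- Off the fibre, i.e. at isolated points of D, the C-coordinate is replaced so that π₁ and π₂ commute.
  fibreC : Pt → Carrier C
  fibreC (b , c) with f b ≟ g c
  ... | yes _ = c
  ... | no _ = proj₁ (surj ψ (f b))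

  fibreC-commutes : ∀ x → g (fibreC x) ≡ f (proj₁ x)
  fibreC-commutes (b , c) with f b ≟ g c
  ... | yes fb≡gc = sym fb≡gc
  ... | no _ = proj₂ (surj ψ (f b))

  fibreC-fibre : ∀ {x} → InFibre x → fibreC x ≡ proj₂ x
  fibreC-fibre {b , c} fx with f b ≟ g c
  ... | yes _ = refl
  ... | no fb≢gc = ⊥-elim (fb≢gc fx)

  π₁ : (Pt × Pt) × Pt → Carrier B
  π₁ = proj₁ ∘ proj₂

  π₂ : (Pt × Pt) × Pt → Carrier C
  π₂ = fibreC ∘ proj₂

  π-commute : ∀ p → f (π₁ p) ≡ g (π₂ p)
  π-commute p = sym (fibreC-commutes (proj₂ p))

  π₂-Kept : ∀ {k x} → Kept k x → π₂ (k , x) ≡ proj₂ x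
  π₂-Kept {s , e} Kx = fibreC-fibre (Kept-fibre Kx)

  Kept-start : ∀ {s e} → Valid s e → Kept (s , e) s
  Kept-start v = v , inj₁ ε

  Kept-end : ∀ {s e} → Valid s e → Kept (s , e) e
  Kept-end v = v , inj₂ refl

  ⊑-span : ∀ {s e} → Valid s e → ((s , e) , s) ⊑ ((s , e) , e)
  ⊑-span v = ⊑-chain (Kept-start v , Kept-end v , Valid.start≤end v)

  single-step-⋖ : ∀ {s e} → Valid s e → s ≢ e → (∀ {z} → InFibre z → s ≤ₚ z → z ≤ₚ e → z ≡ s ⊎ z ≡ e) →
                  ImmSucc _⊑_ ((s , e) , s) ((s , e) , e)
  single-step-⋖ v s≢e no-between = ⋖-chain⁺ ((( Kept-start v , Kept-end v , Valid.start≤end v) , s≢e) ,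
    λ z (((_ , Kz , s≤z) , s≢z) , ((_ , _ , z≤e) , z≢e)) →
      Sum.[ s≢z ∘ sym , z≢e ] (no-between (Kept-fibre Kz) s≤z z≤e))

  no-fibre-point-between : ∀ {b₁ b₂ c₁ c₂} → b₁ ≡ b₂ ⊎ ImmSucc (Le B) b₁ b₂ → c₁ ≡ c₂ ⊎ ImmSucc (Le C) c₁ c₂ →
    InFibre (b₁ , c₁) → InFibre (b₂ , c₂) → (f b₁ ≡ f b₂ → b₁ ≡ b₂ ⊎ c₁ ≡ c₂) →
    ∀ {z} → InFibre z → (b₁ , c₁) ≤ₚ z → z ≤ₚ (b₂ , c₂) → z ≡ (b₁ , c₁) ⊎ z ≡ (b₂ , c₂)
  no-fibre-point-between b-step c-step f₁ f₂ image-fixed fz (b₁≤ , c₁≤) (≤b₂ , ≤c₂)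
    with B.⋖-squeeze b-step b₁≤ ≤b₂ | C.⋖-squeeze c-step c₁≤ ≤c₂
  ... | inj₁ refl | inj₁ refl = inj₁ refl
  ... | inj₂ refl | inj₂ refl = inj₂ refl
  ... | inj₁ refl | inj₂ refl with image-fixed (trans fz (sym f₂))
  ...   | inj₁ refl = inj₂ refl
  ...   | inj₂ refl = inj₁ refl
  no-fibre-point-between b-step c-step f₁ f₂ image-fixed fz _ _ | inj₂ refl | inj₁ refl
    with image-fixed (trans f₁ (sym fz))
  ...   | inj₁ refl = inj₁ refl
  ...   | inj₂ refl = inj₂ refl

  lift-cover₁ : ∀ {b₁ b₂} → ImmSucc (Le B) b₁ b₂ → ∃₂ λ p q → π₁ p ≡ b₁ × π₁ q ≡ b₂ × ImmSucc _⊑_ p q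
  lift-cover₁ {b₁} {b₂} b⋖b with f b₁ ≟ f b₂
  ... | yes same = _ , _ , refl , refl , single-step-⋖ (valid f₁ (B.⋖⇒≤ b⋖b , ≤C.refl) f₂) (B.⋖⇒≢ b⋖b ∘ cong proj₁)
          (no-fibre-point-between (inj₂ b⋖b) (inj₁ refl) f₁ f₂ (λ _ → inj₂ refl))
    where
    f₁ : f b₁ ≡ g (proj₁ (surj ψ (f b₁)))
    f₁ = sym (proj₂ (surj ψ (f b₁)))
    f₂ = trans (sym same) f₁
  ... | no moved with Epi-cover-lift hA hC ψ (Epi-cover-image hA hB φ b⋖b moved)
  ...   | c₁ , c₂ , gc₁ , gc₂ , c⋖c = _ , _ , refl , refl ,
          single-step-⋖ (valid (sym gc₁) (B.⋖⇒≤ b⋖b , C.⋖⇒≤ c⋖c) (sym gc₂)) (B.⋖⇒≢ b⋖b ∘ cong proj₁)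
            (no-fibre-point-between (inj₂ b⋖b) (inj₂ c⋖c) (sym gc₁) (sym gc₂) (⊥-elim ∘ moved))

  lift-cover₂ : ∀ {c₁ c₂} → ImmSucc (Le C) c₁ c₂ → ∃₂ λ p q → π₂ p ≡ c₁ × π₂ q ≡ c₂ × ImmSucc _⊑_ p q
  lift-cover₂ {c₁} {c₂} c⋖c with g c₁ ≟ g c₂
  ... | yes same = _ , _ , fibreC-fibre f₁ , fibreC-fibre f₂ ,
          single-step-⋖ (valid f₁ (≤B.refl , C.⋖⇒≤ c⋖c) f₂) (C.⋖⇒≢ c⋖c ∘ cong proj₂)
            (no-fibre-point-between (inj₁ refl) (inj₂ c⋖c) f₁ f₂ (λ _ → inj₁ refl))
    where
    f₁ : f (proj₁ (surj φ (g c₁))) ≡ g c₁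
    f₁ = proj₂ (surj φ (g c₁))
    f₂ = trans f₁ same
  ... | no moved with Epi-cover-lift hA hB φ (Epi-cover-image hA hC ψ c⋖c moved)
  ...   | b₁ , b₂ , fb₁ , fb₂ , b⋖b = _ , _ , fibreC-fibre fb₁ , fibreC-fibre fb₂ ,
          single-step-⋖ (valid fb₁ (B.⋖⇒≤ b⋖b , C.⋖⇒≤ c⋖c) fb₂) (C.⋖⇒≢ c⋖c ∘ cong proj₂)
            (no-fibre-point-between (inj₂ b⋖b) (inj₂ c⋖c) fb₁ fb₂
              (λ same → ⊥-elim (moved (trans (sym fb₁) (trans same fb₂)))))

  D-HasseForest : HasseForest D
  D-HasseForest = Hasse-HasseForest ⊑-isPartialOrder lower-covers-comparable upper-covers-comparable

  π₁-Epi : Epi D B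
  π₁-Epi = Hasse-epi hB π₁
    (λ b → (((b , zero) , (b , zero)) , (b , zero)) , refl)
    (λ { ⊑-refl → ≤B.refl ; (⊑-chain (_ , _ , b≤ , _)) → b≤ })
    (λ {b₁} {b₂} b≤ → let c₁ , c₂ , gc₁ , gc₂ , c≤ = Le-img ψ (f b₁) (f b₂) (Le-pres φ b₁ b₂ b≤) in
       _ , _ , refl , refl , ⊑-span (valid (sym gc₁) (b≤ , c≤) (sym gc₂)))
    (λ p⋖q → cover (⋖-chain⁻ p⋖q))
    lift-cover₁
    where
    cover : ∀ {p q} → ChainCover p q → R B (π₁ p) (π₁ q)
    cover (chain-cover x⋖y@(((_ , _ , b≤ , _) , _) , _)) =
      B.R-stable b≤ (λ ¬r → cover⇒¬¬Step x⋖y (¬r ∘ proj₁ ∘ Step.rise₁))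

  π₂-Epi : Epi D C
  π₂-Epi = Hasse-epi hC π₂
    (λ c → let b , fb = surj φ (g c) in (((b , c) , (b , c)) , (b , c)) , fibreC-fibre fb)
    (λ { ⊑-refl → ≤C.refl
       ; (⊑-chain (Kx , Ky , _ , c≤)) → subst₂ (Le C) (sym (π₂-Kept Kx)) (sym (π₂-Kept Ky)) c≤ })
    (λ {c₁} {c₂} c≤ → let b₁ , b₂ , fb₁ , fb₂ , b≤ = Le-img φ (g c₁) (g c₂) (Le-pres ψ c₁ c₂ c≤) in
       _ , _ , fibreC-fibre fb₁ , fibreC-fibre fb₂ , ⊑-span (valid fb₁ (b≤ , c≤) fb₂))
    (λ p⋖q → cover (⋖-chain⁻ p⋖q))
    lift-cover₂
    where
    cover : ∀ {p q} → ChainCover p q → R C (π₂ p) (π₂ q)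
    cover (chain-cover x⋖y@(((Kx , Ky , _ , c≤) , _) , _)) = subst₂ (R C) (sym (π₂-Kept Kx)) (sym (π₂-Kept Ky))
      (C.R-stable c≤ (λ ¬r → cover⇒¬¬Step x⋖y (¬r ∘ proj₁ ∘ Step.rise₂)))

amalgamation : AP HasseForest
amalgamation A B C forestA forestB forestC φ ψ = D , D-HasseForest , π₁-Epi , π₂-Epi , π-commute ∘ to
  where
  open Amalgam forestA (proj₁ forestB) (proj₁ forestC) φ ψ
  open Inverse enum using (to)

point : Str
point = record { size = 0 ; R = _≡_ ; Le = _≡_ }

point-HasseForest : HasseForest point
point-HasseForest = record
  { isPartialOrder = ≡.isPartialOrder
  ; R-hasse = λ _ _ → inj₁
  ; hasse-R = λ _ _ → Sum.[ (λ x≡y → x≡y) , Sum.[ absurd , sym ∘ absurd ] ] }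
  , λ cycle → let r , x≢y = Cycle.step cycle zero in x≢y r
  where
  absurd : ∀ {x y : Fin 1} → ImmSucc _≡_ x y → x ≡ y
  absurd ((x≡y , x≢y) , _) = ⊥-elim (x≢y x≡y)

Epi-point : ∀ {A} → IsHPO A → Epi A point
Epi-point hA = record
  { fun = λ _ → zero
  ; surj = λ { zero → zero , refl }
  ; R-img = λ { zero zero _ → zero , zero , refl , refl , HPO.R-refl hA zero }
  ; R-pres = λ _ _ _ → refl
  ; Le-img = λ { zero zero _ → zero , zero , refl , refl , IsPartialOrder.refl (IsHPO.isPartialOrder hA) }
  ; Le-pres = λ _ _ _ → refl }

joint-projection : JPP HasseForest
joint-projection A B forestA forestB
  with amalgamation point A B point-HasseForest forestA forestB (Epi-point (proj₁ forestA)) (Epi-point (proj₁ forestB))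
... | D , forestD , ψ₁ , ψ₂ , _ = D , forestD , ψ₁ , ψ₂

theorem3p6 : ProjectiveFraisse HasseForest
theorem3p6 = joint-projection , amalgamation
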